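{- Let $S$ and $S'$ be binary diagrams with $\mathbf B(S)=\mathbf B(S')$. Then $S$ and $S'$ have the same number of arcs and the same length, and they have the same block list: $\mathcal L(S)=\mathcal L(S')$.
   Context: A diagram of length $n$ is a simple graph on sites $\{1,\dots,n\}$ whose edges (arcs) are pairs $(s_1,s_2)$ with $s_1<s_2$ and $1<s_2-s_1<n-1$, supported by $s_1,s_2$. A diagram is binary if it has at least one arc and each site supports at most one arc. A site is free if it supports no arc. If $u_1<\dots<u_f$ are the free sites, $u_0=0$, $u_{f+1}=n+1$, the $i$-th block $B_i$ ($1\le i\le f+1$) is the (possibly empty) set of sites $s$ with $u_{i-1}<s<u_i$, and the block list is $\mathcal L(S)=(B_1,\dots,B_{f+1})$. The block matrix $\mathbf B(S)=(b_{i,j})$ is the symmetric $(f+1)\times(f+1)$ matrix where, for $i\ne j$, $b_{i,j}$ is the number of arcs with one supporting site in $B_i$ and the other in $B_j$, and $b_{i,i}$ is the number of arcs with both supporting sites in $B_i$. -}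

module Defs where

open import Data.Nat using (ℕ; zero; suc; _≤_; _<_; _∸_; _≡ᵇ_; _<ᵇ_)
open import Data.Bool using (Bool; true; false; _∧_; _∨_; not)
open import Data.List using (List; []; _∷_; map; length; upTo; filterᵇ; zipWith; _++_; [_])
open import Data.Bool.ListAction using (any)
open import Data.List.Relation.Unary.All using (All)
open import Data.List.Relation.Unary.Unique.Propositional using (Unique)
open import Data.Product using (_×_; _,_; proj₁; proj₂)
open import Relation.Binary.PropositionalEquality using (_≡_; _≢_)

-- An arc (s₁ , s₂) of a diagram of length n: 1 ≤ s₁ < s₂ ≤ n and
-- 1 < s₂ - s₁ < n - 1  (note s₂ ∸ s₁ ≥ 2 > 0, and for n = 0 the bound
-- n ∸ 1 = 0 correctly excludes arcs, as does n - 1 = -1).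
Arc : Set
Arc = ℕ × ℕ

IsArc : ℕ → Arc → Set
IsArc n (s₁ , s₂) = (1 ≤ s₁) × (s₁ < s₂) × (s₂ ≤ n) × (1 < s₂ ∸ s₁) × (s₂ ∸ s₁ < n ∸ 1)

-- A diagram: its length n and its (finite) set of arcs, given as a
-- duplicate-free list (a simple graph on sites {1,…,n}).
record Diagram : Set where
  field
    len    : ℕ
    arcs   : List Arc
    valid  : All (IsArc len) arcs
    simple : Unique arcs
open Diagram public

sites : ℕ → List ℕ
sites n = map suc (upTo n)

supportsᵇ : ℕ → Arc → Bool
supportsᵇ s (s₁ , s₂) = (s ≡ᵇ s₁) ∨ (s ≡ᵇ s₂)

numArcs : Diagram → ℕ
numArcs S = length (arcs S)

Binary : Diagram → Set
Binary S = (arcs S ≢ []) × (∀ s → length (filterᵇ (supportsᵇ s) (arcs S)) ≤ 1)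

freeSites : Diagram → List ℕ
freeSites S = filterᵇ (λ s → not (any (supportsᵇ s) (arcs S))) (sites (len S))

boundaries : Diagram → List ℕ
boundaries S = 0 ∷ (freeSites S ++ [ suc (len S) ])

tail' : List ℕ → List ℕ
tail' []       = []
tail' (_ ∷ xs) = xs

block : ℕ → ℕ → ℕ → List ℕ
block n a b = filterᵇ (λ s → (a <ᵇ s) ∧ (s <ᵇ b)) (sites n)

blockList : Diagram → List (List ℕ)
blockList S = zipWith (block (len S)) (boundaries S) (tail' (boundaries S))

_∈ᵇ_ : ℕ → List ℕ → Bool
s ∈ᵇ B = any (s ≡ᵇ_) B

-- number of arcs with one supporting site in Bᵢ and the other in Bⱼ
-- (for Bᵢ = Bⱼ: both supporting sites in Bᵢ)
entry : List Arc → List ℕ → List ℕ → ℕ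
entry as Bᵢ Bⱼ = length (filterᵇ
  (λ { (s₁ , s₂) → ((s₁ ∈ᵇ Bᵢ) ∧ (s₂ ∈ᵇ Bⱼ)) ∨ ((s₁ ∈ᵇ Bⱼ) ∧ (s₂ ∈ᵇ Bᵢ)) }) as)

-- block matrix 𝐁(S), as the list of its rows (so its size f+1 is part of the data)
blockMatrix : Diagram → List (List ℕ)
blockMatrix S = map (λ Bᵢ → map (λ Bⱼ → entry (arcs S) Bᵢ Bⱼ) (blockList S)) (blockList S)

-- Every site of a block of a binary diagram supports exactly one arc, so for each block Bᵢ
-- the row sum Σⱼ bᵢⱼ plus the diagonal entry bᵢᵢ counts the arc endpoints in Bᵢ, which is |Bᵢ|
-- (an arc inside Bᵢ is counted once in the row and once more on the diagonal).  Thus 𝐁(S)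
-- determines the block sizes, whose sum is twice the number of arcs.  The boundaries
-- 0 = u₀ < u₁ < … < u_{f+1} = n + 1 satisfy uᵢ = uᵢ₋₁ + |Bᵢ| + 1, so the block sizes also
-- determine the free sites and the length n, and with them the block list.

module Submission where

open import Defs
open import Data.Nat using (ℕ; zero; suc; _+_; _*_; _∸_; _⊓_; _≤_; _<_; _≡ᵇ_; _<ᵇ_; z≤n; s≤s)
open import Data.Nat.Properties
open import Algebra.Properties.CommutativeSemigroup +-commutativeSemigroup using (interchange)
open import Data.Nat.ListAction using (sum)
open import Data.Bool using (Bool; true; false; _∧_; _∨_; not; T; T?)
open import Data.Bool.Properties using (∧-zeroʳ; ∧-identityʳ; ∨-identityʳ; T-∧; T-∨; T-not-≡)
open import Data.Bool.ListAction using (any)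
open import Data.List using (List; []; _∷_; map; length; upTo; filterᵇ; zipWith; take; drop; _++_; [_])
open import Data.List.Properties
  using (map-∘; map-cong; map-cong-local; map-++; map-upTo; upTo-∷ʳ; drop-map; drop-drop; length-++;
         filter-++; filter-some; ∷-injective; ∷ʳ-injectiveʳ)
open import Data.List.Membership.Propositional using (_∈_; _∉_)
open import Data.List.Membership.Propositional.Properties
  using (∈-map⁺; ∈-map⁻; ∈-upTo⁺; ∈-upTo⁻; ∈-filter⁺; ∈-filter⁻; ∈-++⁺ˡ; ∈-++⁻)
open import Data.List.Relation.Unary.All as All using (All; []; _∷_)
import Data.List.Relation.Unary.All.Properties as Allₚ
open Allₚ using (All¬⇒¬Any)
open import Data.List.Relation.Unary.Any as Any using (Any; here; there)
import Data.List.Relation.Unary.Any.Properties as Anyₚ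
open Anyₚ using (any⁺; any⁻)
open import Data.List.Relation.Unary.AllPairs as AllPairs using (AllPairs; []; _∷_)
import Data.List.Relation.Unary.AllPairs.Properties as AllPairsₚ
open import Data.List.Relation.Unary.Unique.Propositional using (Unique)
open import Data.Product using (_×_; _,_; proj₁; proj₂; ∃₂)
open import Data.Empty using (⊥; ⊥-elim)
open import Data.Sum using (inj₁; inj₂)
open import Function using (_∘_)
open import Function.Bundles using (Equivalence)
open import Relation.Binary.Definitions using (tri<; tri≈; tri>)
open import Relation.Nullary.Reflects using (Reflects; ofʸ; ofⁿ; det; fromEquivalence)
open import Relation.Binary.PropositionalEquality hiding ([_])

private variable
  X Y Z W : Set

𝟙 : Bool → ℕ
𝟙 true  = 1
𝟙 false = 0

𝟙-∨ : ∀ a b → (T a → T b → ⊥) → 𝟙 (a ∨ b) ≡ 𝟙 a + 𝟙 b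
𝟙-∨ true  true  disjoint = ⊥-elim (disjoint _ _)
𝟙-∨ true  false _        = refl
𝟙-∨ false _     _        = refl

length-filterᵇ : ∀ (p : X → Bool) xs → length (filterᵇ p xs) ≡ sum (map (𝟙 ∘ p) xs)
length-filterᵇ p []       = refl
length-filterᵇ p (x ∷ xs) with p x
... | true  = cong suc (length-filterᵇ p xs)
... | false = length-filterᵇ p xs

sum-map-cong : ∀ {f g : X → ℕ} xs → (∀ {x} → x ∈ xs → f x ≡ g x) →
  sum (map f xs) ≡ sum (map g xs)
sum-map-cong xs f≗g = cong sum (map-cong-local (All.tabulate f≗g))

sum-map-const : ∀ c (xs : List X) → sum (map (λ _ → c) xs) ≡ c * length xs
sum-map-const c []       = sym (*-zeroʳ c)
sum-map-const c (x ∷ xs) = trans (cong (c +_) (sum-map-const c xs)) (sym (*-suc c (length xs)))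

sum-map-+ : ∀ (f g : X → ℕ) xs → sum (map (λ x → f x + g x) xs) ≡ sum (map f xs) + sum (map g xs)
sum-map-+ f g []       = refl
sum-map-+ f g (x ∷ xs) =
  trans (cong (f x + g x +_) (sum-map-+ f g xs))
        (interchange (f x) (g x) (sum (map f xs)) (sum (map g xs)))

sum-map-swap : ∀ (f : X → Y → ℕ) xs ys →
  sum (map (λ x → sum (map (f x) ys)) xs) ≡ sum (map (λ y → sum (map (λ x → f x y) xs)) ys)
sum-map-swap f []       ys = sym (sum-map-const 0 ys)
sum-map-swap f (x ∷ xs) ys =
  trans (cong (sum (map (f x) ys) +_) (sum-map-swap f xs ys)) (sym (sum-map-+ (f x) _ ys))

≡ᵇ-reflects : ∀ m n → Reflects (m ≡ n) (m ≡ᵇ n)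
≡ᵇ-reflects m n = fromEquivalence (≡ᵇ⇒≡ m n) (≡⇒≡ᵇ m n)

∈ᵇ-reflects : ∀ s xs → Reflects (s ∈ xs) (s ∈ᵇ xs)
∈ᵇ-reflects s []       = ofⁿ λ ()
∈ᵇ-reflects s (x ∷ xs) with s ≡ᵇ x | ≡ᵇ-reflects s x | s ∈ᵇ xs | ∈ᵇ-reflects s xs
... | true  | ofʸ refl | _     | _        = ofʸ (here refl)
... | false | _        | true  | ofʸ s∈xs = ofʸ (there s∈xs)
... | false | ofⁿ s≢x  | false | ofⁿ s∉xs =
  ofⁿ λ { (here s≡x) → s≢x s≡x ; (there s∈xs) → s∉xs s∈xs }

∈⇒∈ᵇ : ∀ {s xs} → s ∈ xs → s ∈ᵇ xs ≡ true
∈⇒∈ᵇ s∈xs = det (∈ᵇ-reflects _ _) (ofʸ s∈xs)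

∉⇒∈ᵇ : ∀ {s xs} → s ∉ xs → s ∈ᵇ xs ≡ false
∉⇒∈ᵇ s∉xs = det (∈ᵇ-reflects _ _) (ofⁿ s∉xs)

sum-𝟙-≡ᵇ : ∀ t {xs} → Unique xs → sum (map (λ s → 𝟙 (s ≡ᵇ t)) xs) ≡ 𝟙 (t ∈ᵇ xs)
sum-𝟙-≡ᵇ t []                        = refl
sum-𝟙-≡ᵇ t {x ∷ xs} (x≢xs ∷ unique) with x ≡ᵇ t | ≡ᵇ-reflects x t | t ≡ᵇ x | ≡ᵇ-reflects t x
... | true  | ofʸ refl | true  | _        =
  cong suc (trans (sum-𝟙-≡ᵇ t unique) (cong 𝟙 (∉⇒∈ᵇ (All¬⇒¬Any x≢xs))))
... | true  | ofʸ refl | false | ofⁿ t≢t  = ⊥-elim (t≢t refl)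
... | false | ofⁿ x≢t  | true  | ofʸ refl = ⊥-elim (x≢t refl)
... | false | _        | false | _        = sum-𝟙-≡ᵇ t unique

diagonalFrom : ℕ → List (List X) → List X
diagonalFrom k []       = []
diagonalFrom k (r ∷ rs) = take 1 (drop k r) ++ diagonalFrom (suc k) rs

diagonal : List (List X) → List X
diagonal = diagonalFrom 0

drop-suc : ∀ k {x : X} {xs} ys → drop k ys ≡ x ∷ xs → drop (suc k) ys ≡ xs
drop-suc k ys eq =
  trans (cong (λ m → drop m ys) (+-comm 1 k)) (trans (sym (drop-drop k 1 ys)) (cong (drop 1) eq))

diagonalFrom-table : ∀ (f : X → X → Y) k ys xs → drop k ys ≡ xs →
  diagonalFrom k (map (λ x → map (f x) ys) xs) ≡ map (λ x → f x x) xs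
diagonalFrom-table f k ys []       _  = refl
diagonalFrom-table f k ys (x ∷ xs) eq =
  cong₂ _++_ head-entry (diagonalFrom-table f (suc k) ys xs (drop-suc k ys eq))
  where
  head-entry : take 1 (drop k (map (f x) ys)) ≡ [ f x x ]
  head-entry = cong (take 1) (trans (drop-map k ys) (cong (map (f x)) eq))

zipWith-map-map : ∀ (_⊕_ : X → Y → Z) (g : W → X) (h : W → Y) xs →
  zipWith _⊕_ (map g xs) (map h xs) ≡ map (λ x → g x ⊕ h x) xs
zipWith-map-map _⊕_ g h []       = refl
zipWith-map-map _⊕_ g h (x ∷ xs) = cong (g x ⊕ h x ∷_) (zipWith-map-map _⊕_ g h xs)

rowSum+diagonal : List (List ℕ) → List ℕ
rowSum+diagonal M = zipWith _+_ (map sum M) (diagonal M)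

rowSum+diagonal-table : ∀ (f : X → X → ℕ) xs →
  rowSum+diagonal (map (λ x → map (f x) xs) xs) ≡ map (λ x → sum (map (f x) xs) + f x x) xs
rowSum+diagonal-table {X = X} f xs = begin
  zipWith _+_ (map sum (map row xs)) (diagonal (map row xs))
    ≡⟨ cong₂ (zipWith _+_) (sym (map-∘ xs)) (diagonalFrom-table f 0 xs xs refl) ⟩
  zipWith _+_ (map (sum ∘ row) xs) (map (λ x → f x x) xs)
    ≡⟨ zipWith-map-map _+_ (sum ∘ row) (λ x → f x x) xs ⟩
  map (λ x → sum (row x) + f x x) xs ∎
  where
  open ≡-Reasoning
  row : X → List ℕ
  row x = map (f x) xs

joins : List ℕ → List ℕ → Arc → Bool
joins Bᵢ Bⱼ (s₁ , s₂) = ((s₁ ∈ᵇ Bᵢ) ∧ (s₂ ∈ᵇ Bⱼ)) ∨ ((s₁ ∈ᵇ Bⱼ) ∧ (s₂ ∈ᵇ Bᵢ))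

entry≡sum-joins : ∀ as Bᵢ Bⱼ → entry as Bᵢ Bⱼ ≡ sum (map (𝟙 ∘ joins Bᵢ Bⱼ) as)
entry≡sum-joins as Bᵢ Bⱼ =
  trans (length-filterᵇ _ as) (cong sum (map-cong (λ { (s₁ , s₂) → refl }) as))

incidence : List ℕ → Arc → ℕ
incidence B (s₁ , s₂) = 𝟙 (s₁ ∈ᵇ B) + 𝟙 (s₂ ∈ᵇ B)

Covers : List (List ℕ) → ℕ → Set
Covers L s = sum (map (λ B → 𝟙 (s ∈ᵇ B)) L) ≡ 1

Nonoverlapping : List (List ℕ) → Set
Nonoverlapping L = ∀ {B B′ s} → B ∈ L → B′ ∈ L → s ∈ B → s ∈ B′ → B ≡ B′

EndpointsCovered : List (List ℕ) → List Arc → Set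
EndpointsCovered L as = ∀ {s₁ s₂} → (s₁ , s₂) ∈ as → Covers L s₁ × Covers L s₂

module _ {L : List (List ℕ)} (nonoverlapping : Nonoverlapping L) where

  sum-joins+joins≡incidence : ∀ {B s₁ s₂} → B ∈ L → Covers L s₁ → Covers L s₂ →
    sum (map (λ B′ → 𝟙 (joins B B′ (s₁ , s₂))) L) + 𝟙 (joins B B (s₁ , s₂)) ≡ incidence B (s₁ , s₂)
  sum-joins+joins≡incidence {B} {s₁} {s₂} B∈L cover₁ cover₂
    with s₁ ∈ᵇ B | ∈ᵇ-reflects s₁ B | s₂ ∈ᵇ B | ∈ᵇ-reflects s₂ B
  ... | true  | ofʸ s₁∈B | true  | ofʸ s₂∈B = cong (_+ 1) (trans (sum-map-cong L both) cover₁)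
    where
    both : ∀ {B′} → B′ ∈ L → 𝟙 ((s₂ ∈ᵇ B′) ∨ ((s₁ ∈ᵇ B′) ∧ true)) ≡ 𝟙 (s₁ ∈ᵇ B′)
    both {B′} B′∈L with s₁ ∈ᵇ B′ | ∈ᵇ-reflects s₁ B′ | s₂ ∈ᵇ B′ | ∈ᵇ-reflects s₂ B′
    ... | true  | _         | true  | _         = refl
    ... | false | _         | false | _         = refl
    ... | true  | ofʸ s₁∈B′ | false | ofⁿ s₂∉B′ =
      ⊥-elim (s₂∉B′ (subst (s₂ ∈_) (nonoverlapping B∈L B′∈L s₁∈B s₁∈B′) s₂∈B))
    ... | false | ofⁿ s₁∉B′ | true  | ofʸ s₂∈B′ =
      ⊥-elim (s₁∉B′ (subst (s₁ ∈_) (nonoverlapping B∈L B′∈L s₂∈B s₂∈B′) s₁∈B))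
  ... | true  | _ | false | _ = cong (_+ 0) (trans (sum-map-cong L λ {B′} _ →
    cong 𝟙 (trans (cong ((s₂ ∈ᵇ B′) ∨_) (∧-zeroʳ (s₁ ∈ᵇ B′))) (∨-identityʳ (s₂ ∈ᵇ B′)))) cover₂)
  ... | false | _ | true  | _ = cong (_+ 0) (trans (sum-map-cong L λ {B′} _ →
    cong 𝟙 (∧-identityʳ (s₁ ∈ᵇ B′))) cover₁)
  ... | false | _ | false | _ = cong (_+ 0) (trans (sum-map-cong L λ {B′} _ →
    cong 𝟙 (∧-zeroʳ (s₁ ∈ᵇ B′))) (sum-map-const 0 L))

  row+diagonal≡sum-incidence : ∀ {B} as → B ∈ L → EndpointsCovered L as →
    sum (map (entry as B) L) + entry as B B ≡ sum (map (incidence B) as)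
  row+diagonal≡sum-incidence {B} as B∈L covered = begin
    sum (map (entry as B) L) + entry as B B
      ≡⟨ cong₂ _+_ (sum-map-cong L (λ {B′} _ → entry≡sum-joins as B B′)) (entry≡sum-joins as B B) ⟩
    sum (map (λ B′ → sum (map (𝟙 ∘ joins B B′) as)) L) + sum (map (𝟙 ∘ joins B B) as)
      ≡⟨ cong (_+ _) (sum-map-swap (λ B′ a → 𝟙 (joins B B′ a)) L as) ⟩
    sum (map (λ a → sum (map (λ B′ → 𝟙 (joins B B′ a)) L)) as) + sum (map (𝟙 ∘ joins B B) as)
      ≡⟨ sum-map-+ _ _ as ⟨
    sum (map (λ a → sum (map (λ B′ → 𝟙 (joins B B′ a)) L) + 𝟙 (joins B B a)) as)
      ≡⟨ sum-map-cong as (λ { {s₁ , s₂} a∈as → let cover₁ , cover₂ = covered a∈as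
                                               in sum-joins+joins≡incidence {s₁ = s₁} {s₂} B∈L cover₁ cover₂ }) ⟩
    sum (map (incidence B) as) ∎
    where open ≡-Reasoning

sum-sum-incidence : ∀ L as → EndpointsCovered L as →
  sum (map (λ B → sum (map (incidence B) as)) L) ≡ 2 * length as
sum-sum-incidence L as covered = begin
  sum (map (λ B → sum (map (incidence B) as)) L)  ≡⟨ sum-map-swap incidence L as ⟩
  sum (map (λ a → sum (map (λ B → incidence B a) L)) as)
    ≡⟨ sum-map-cong as (λ { {s₁ , s₂} a∈as → let cover₁ , cover₂ = covered a∈as
                                             in trans (sum-map-+ _ _ L) (cong₂ _+_ cover₁ cover₂) }) ⟩
  sum (map (λ _ → 2) as)                          ≡⟨ sum-map-const 2 as ⟩
  2 * length as                                   ∎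
  where open ≡-Reasoning

degree : List Arc → ℕ → ℕ
degree as s = length (filterᵇ (supportsᵇ s) as)

sum-degree≡sum-incidence : ∀ {B} as → Unique B → (∀ {s₁ s₂} → (s₁ , s₂) ∈ as → s₁ ≢ s₂) →
  sum (map (degree as) B) ≡ sum (map (incidence B) as)
sum-degree≡sum-incidence {B} as unique loopless = begin
  sum (map (degree as) B)
    ≡⟨ sum-map-cong B (λ {s} _ → length-filterᵇ (supportsᵇ s) as) ⟩
  sum (map (λ s → sum (map (𝟙 ∘ supportsᵇ s) as)) B)
    ≡⟨ sum-map-swap (λ s a → 𝟙 (supportsᵇ s a)) B as ⟩
  sum (map (λ a → sum (map (λ s → 𝟙 (supportsᵇ s a)) B)) as)
    ≡⟨ sum-map-cong as (λ { {s₁ , s₂} a∈as → endpoints (loopless a∈as) }) ⟩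
  sum (map (incidence B) as) ∎
  where
  open ≡-Reasoning
  endpoints : ∀ {s₁ s₂} → s₁ ≢ s₂ →
    sum (map (λ s → 𝟙 ((s ≡ᵇ s₁) ∨ (s ≡ᵇ s₂))) B) ≡ 𝟙 (s₁ ∈ᵇ B) + 𝟙 (s₂ ∈ᵇ B)
  endpoints {s₁} {s₂} s₁≢s₂ = begin
    sum (map (λ s → 𝟙 ((s ≡ᵇ s₁) ∨ (s ≡ᵇ s₂))) B)
      ≡⟨ sum-map-cong B (λ {s} _ → 𝟙-∨ (s ≡ᵇ s₁) (s ≡ᵇ s₂) λ p q →
           s₁≢s₂ (trans (sym (≡ᵇ⇒≡ s s₁ p)) (≡ᵇ⇒≡ s s₂ q))) ⟩
    sum (map (λ s → 𝟙 (s ≡ᵇ s₁) + 𝟙 (s ≡ᵇ s₂)) B)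
      ≡⟨ sum-map-+ _ _ B ⟩
    sum (map (λ s → 𝟙 (s ≡ᵇ s₁)) B) + sum (map (λ s → 𝟙 (s ≡ᵇ s₂)) B)
      ≡⟨ cong₂ _+_ (sum-𝟙-≡ᵇ s₁ unique) (sum-𝟙-≡ᵇ s₂ unique) ⟩
    𝟙 (s₁ ∈ᵇ B) + 𝟙 (s₂ ∈ᵇ B) ∎

between : ℕ → ℕ → ℕ → Bool
between a b s = (a <ᵇ s) ∧ (s <ᵇ b)

∈-sites⁻ : ∀ {n s} → s ∈ sites n → 1 ≤ s × s ≤ n
∈-sites⁻ s∈sites with _ , i∈upTo , refl ← ∈-map⁻ suc s∈sites = s≤s z≤n , ∈-upTo⁻ i∈upTo

∈-sites⁺ : ∀ {n s} → 1 ≤ s → s ≤ n → s ∈ sites n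
∈-sites⁺ {s = suc i} _ s≤n = ∈-map⁺ suc (∈-upTo⁺ s≤n)

sites-increasing : ∀ n → AllPairs _<_ (sites n)
sites-increasing n =
  subst (AllPairs _<_) (sym (map-upTo suc n)) (AllPairsₚ.applyUpTo⁺₁ suc n (λ i<j _ → s≤s i<j))

sites-suc : ∀ n → sites (suc n) ≡ sites n ++ [ suc n ]
sites-suc n = trans (cong (map suc) (sym (upTo-∷ʳ n))) (map-++ suc (upTo n) [ n ])

∈-block⁻ : ∀ n a b {s} → s ∈ block n a b → a < s × s < b
∈-block⁻ n a b {s} s∈B
  with a<s , s<b ← Equivalence.to T-∧ (proj₂ (∈-filter⁻ (T? ∘ between a b) {xs = sites n} s∈B)) =
  <ᵇ⇒< a s a<s , <ᵇ⇒< s b s<b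

block⊆sites : ∀ n a b {s} → s ∈ block n a b → s ∈ sites n
block⊆sites n a b s∈B = proj₁ (∈-filter⁻ (T? ∘ between a b) {xs = sites n} s∈B)

∈-block⁺ : ∀ {n a b s} → s ∈ sites n → a < s → s < b → s ∈ block n a b
∈-block⁺ {a = a} {b} s∈sites a<s s<b =
  ∈-filter⁺ (T? ∘ between a b) s∈sites (Equivalence.from T-∧ (<⇒<ᵇ a<s , <⇒<ᵇ s<b))

block-unique : ∀ n a b → Unique (block n a b)
block-unique n a b = AllPairsₚ.filter⁺ (T? ∘ _) (AllPairs.map <⇒≢ (sites-increasing n))

-- Stated for every b (hence the ⊓) so that the induction on n goes through.
length-block : ∀ n a b → length (block n a b) ≡ (b ⊓ suc n) ∸ suc a
length-block zero    a b = sym (m≤n⇒m∸n≡0 (≤-trans (m⊓n≤n b 1) (s≤s z≤n)))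
length-block (suc n) a b = begin
  length (block (suc n) a b)
    ≡⟨ cong (length ∘ filterᵇ (between a b)) (sites-suc n) ⟩
  length (filterᵇ (between a b) (sites n ++ [ suc n ]))
    ≡⟨ cong length (filter-++ (T? ∘ between a b) (sites n) [ suc n ]) ⟩
  length (block n a b ++ filterᵇ (between a b) [ suc n ])
    ≡⟨ length-++ (block n a b) ⟩
  length (block n a b) + length (filterᵇ (between a b) [ suc n ])
    ≡⟨ cong₂ _+_ (length-block n a b) (trans (length-filterᵇ (between a b) [ suc n ]) (+-identityʳ _)) ⟩
  (b ⊓ suc n) ∸ suc a + 𝟙 (between a b (suc n))
    ≡⟨ step (suc n) ⟩
  (b ⊓ suc (suc n)) ∸ suc a ∎
  where
  open ≡-Reasoning
  step : ∀ m → (b ⊓ m) ∸ suc a + 𝟙 (between a b m) ≡ (b ⊓ suc m) ∸ suc a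
  step m with a <ᵇ m | <ᵇ-reflects-< a m | m <ᵇ b | <ᵇ-reflects-< m b
  ... | true  | ofʸ a<m | true  | ofʸ m<b rewrite m≥n⇒m⊓n≡n (<⇒≤ m<b) | m≥n⇒m⊓n≡n m<b =
    trans (+-comm _ 1) (sym (+-∸-assoc 1 a<m))
  ... | false | ofⁿ a≮m | true  | ofʸ m<b rewrite m≥n⇒m⊓n≡n (<⇒≤ m<b) | m≥n⇒m⊓n≡n m<b =
    trans (+-identityʳ _) (trans (m≤n⇒m∸n≡0 (m≤n⇒m≤1+n (≮⇒≥ a≮m))) (sym (m≤n⇒m∸n≡0 (≮⇒≥ a≮m))))
  ... | true  | _ | false | ofⁿ m≮b
    rewrite m≤n⇒m⊓n≡m (≮⇒≥ m≮b) | m≤n⇒m⊓n≡m (m≤n⇒m≤1+n (≮⇒≥ m≮b)) = +-identityʳ _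
  ... | false | _ | false | ofⁿ m≮b
    rewrite m≤n⇒m⊓n≡m (≮⇒≥ m≮b) | m≤n⇒m⊓n≡m (m≤n⇒m≤1+n (≮⇒≥ m≮b)) = +-identityʳ _

blocksAlong : ℕ → List ℕ → List (List ℕ)
blocksAlong n us = zipWith (block n) us (tail' us)

gaps : List ℕ → List ℕ
gaps us = zipWith (λ a b → b ∸ suc a) us (tail' us)

length-blocksAlong : ∀ {n} us → All (_≤ suc n) us → map length (blocksAlong n us) ≡ gaps us
length-blocksAlong []           _                   = refl
length-blocksAlong (u ∷ [])     _                   = refl
length-blocksAlong {n} (u ∷ v ∷ us) (_ ∷ v≤ ∷ bounded) =
  cong₂ _∷_ (trans (length-block n u v) (cong (_∸ suc u) (m≤n⇒m⊓n≡m v≤)))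
            (length-blocksAlong (v ∷ us) (v≤ ∷ bounded))

gaps-injective : ∀ {u us vs} → AllPairs _<_ (u ∷ us) → AllPairs _<_ (u ∷ vs) →
  gaps (u ∷ us) ≡ gaps (u ∷ vs) → us ≡ vs
gaps-injective {us = []}    {[]}    _ _ _ = refl
gaps-injective {us = v ∷ us} {v′ ∷ vs} ((u<v ∷ _) ∷ increasing) ((u<v′ ∷ _) ∷ increasing′) eq
  with refl ← ∸-cancelʳ-≡ u<v u<v′ (proj₁ (∷-injective eq)) =
  cong (v ∷_) (gaps-injective increasing increasing′ (proj₂ (∷-injective eq)))

module _ {n : ℕ} where

  ∈-blocksAlong⁻ : ∀ {us B} → B ∈ blocksAlong n us → ∃₂ λ a b → B ≡ block n a b
  ∈-blocksAlong⁻ {u ∷ v ∷ us} (here refl) = u , v , refl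
  ∈-blocksAlong⁻ {u ∷ v ∷ us} (there B∈) = ∈-blocksAlong⁻ B∈

  blocksAlong-above : ∀ {u us B s} → AllPairs _<_ (u ∷ us) → B ∈ blocksAlong n (u ∷ us) → s ∈ B → u < s
  blocksAlong-above {u} {v ∷ us} _ (here refl) s∈B = proj₁ (∈-block⁻ n u v s∈B)
  blocksAlong-above {u} {v ∷ us} ((u<v ∷ _) ∷ increasing) (there B∈) s∈B =
    <-trans u<v (blocksAlong-above increasing B∈ s∈B)

  blocksAlong-avoids : ∀ {us B s} → AllPairs _<_ us → B ∈ blocksAlong n us → s ∈ B → s ∉ us
  blocksAlong-avoids {u ∷ v ∷ us} _ (here refl) s∈B (here refl) =
    <-irrefl refl (proj₁ (∈-block⁻ n u v s∈B))
  blocksAlong-avoids {u ∷ v ∷ us} _ (here refl) s∈B (there (here refl)) =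
    <-irrefl refl (proj₂ (∈-block⁻ n u v s∈B))
  blocksAlong-avoids {u ∷ v ∷ us} (_ ∷ (v<us ∷ _)) (here refl) s∈B (there (there s∈us)) =
    <-asym (proj₂ (∈-block⁻ n u v s∈B)) (All.lookup v<us s∈us)
  blocksAlong-avoids {u ∷ v ∷ us} increasing (there B∈) s∈B (here refl) =
    <-irrefl refl (blocksAlong-above increasing (there B∈) s∈B)
  blocksAlong-avoids {u ∷ v ∷ us} (_ ∷ increasing) (there B∈) s∈B (there s∈vus) =
    blocksAlong-avoids increasing B∈ s∈B s∈vus

  blocksAlong-nonoverlapping : ∀ {us} → AllPairs _<_ us → Nonoverlapping (blocksAlong n us)
  blocksAlong-nonoverlapping {u ∷ v ∷ us} _ (here refl) (here refl) _ _ = refl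
  blocksAlong-nonoverlapping {u ∷ v ∷ us} (_ ∷ increasing) (here refl) (there B′∈) s∈B s∈B′ =
    ⊥-elim (<-asym (proj₂ (∈-block⁻ n u v s∈B)) (blocksAlong-above increasing B′∈ s∈B′))
  blocksAlong-nonoverlapping {u ∷ v ∷ us} (_ ∷ increasing) (there B∈) (here refl) s∈B s∈B′ =
    ⊥-elim (<-asym (proj₂ (∈-block⁻ n u v s∈B′)) (blocksAlong-above increasing B∈ s∈B))
  blocksAlong-nonoverlapping {u ∷ v ∷ us} (_ ∷ increasing) (there B∈) (there B′∈) =
    blocksAlong-nonoverlapping increasing B∈ B′∈

  blocksAlong-covers : ∀ {u us s} → AllPairs _<_ (u ∷ us) → u < s → s ∉ us → Any (s <_) us →
    s ∈ sites n → Covers (blocksAlong n (u ∷ us)) s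
  blocksAlong-covers {u} {v ∷ us} {s} (_ ∷ increasing) u<s s∉us below s∈sites with <-cmp s v
  ... | tri< s<v _ _ = cong₂ _+_ (cong 𝟙 (∈⇒∈ᵇ (∈-block⁺ s∈sites u<s s<v)))
    (trans (sum-map-cong (blocksAlong n (v ∷ us)) λ B∈ →
              cong 𝟙 (∉⇒∈ᵇ λ s∈B → <-asym s<v (blocksAlong-above increasing B∈ s∈B)))
           (sum-map-const 0 (blocksAlong n (v ∷ us))))
  ... | tri≈ _ s≡v _ = ⊥-elim (s∉us (here s≡v))
  ... | tri> _ _ v<s =
    trans (cong (_+ _) (cong 𝟙 (∉⇒∈ᵇ λ s∈B → <-asym v<s (proj₂ (∈-block⁻ n u v s∈B)))))
          (blocksAlong-covers increasing v<s (s∉us ∘ there) (below-rest below) s∈sites)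
    where
    below-rest : Any (s <_) (v ∷ us) → Any (s <_) us
    below-rest (here s<v) = ⊥-elim (<-asym s<v v<s)
    below-rest (there p)  = p

Supporting : Diagram → ℕ → Set
Supporting S s = T (any (supportsᵇ s) (arcs S))

freeSites⊆sites : ∀ S {s} → s ∈ freeSites S → s ∈ sites (len S)
freeSites⊆sites S s∈F = proj₁ (∈-filter⁻ (T? ∘ _) {xs = sites (len S)} s∈F)

supporting⇒∉freeSites : ∀ S {s} → Supporting S s → s ∉ freeSites S
supporting⇒∉freeSites S supporting s∈F =
  subst T (Equivalence.to T-not-≡ (proj₂ (∈-filter⁻ (T? ∘ _) {xs = sites (len S)} s∈F))) supporting

∉freeSites⇒supporting : ∀ S {s} → s ∈ sites (len S) → s ∉ freeSites S → Supporting S s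
∉freeSites⇒supporting S {s} s∈sites s∉F with any (supportsᵇ s) (arcs S) in eq
... | true  = _
... | false =
  ⊥-elim (s∉F (∈-filter⁺ (T? ∘ λ s → not (any (supportsᵇ s) (arcs S))) s∈sites
                         (subst (T ∘ not) (sym eq) _)))

arc-endpoints : ∀ S {s₁ s₂} → (s₁ , s₂) ∈ arcs S →
  s₁ ∈ sites (len S) × s₂ ∈ sites (len S) × s₁ < s₂
arc-endpoints S a∈ with 1≤s₁ , s₁<s₂ , s₂≤n , _ ← All.lookup (valid S) a∈ =
  ∈-sites⁺ 1≤s₁ (≤-trans (<⇒≤ s₁<s₂) s₂≤n) ,
  ∈-sites⁺ (≤-trans 1≤s₁ (<⇒≤ s₁<s₂)) s₂≤n ,
  s₁<s₂

arc-endpoints-supporting : ∀ S {s₁ s₂} → (s₁ , s₂) ∈ arcs S → Supporting S s₁ × Supporting S s₂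
arc-endpoints-supporting S {s₁} {s₂} a∈ =
  any⁺ _ (Any.map (λ { refl → Equivalence.from T-∨ (inj₁ (≡⇒≡ᵇ s₁ s₁ refl)) }) a∈) ,
  any⁺ _ (Any.map (λ { refl → Equivalence.from T-∨ (inj₂ (≡⇒≡ᵇ s₂ s₂ refl)) }) a∈)

binary⇒degree≡1 : ∀ S {s} → Binary S → Supporting S s → degree (arcs S) s ≡ 1
binary⇒degree≡1 S {s} (_ , atMostOne) supporting =
  ≤-antisym (atMostOne s) (filter-some (T? ∘ supportsᵇ s) (any⁻ (supportsᵇ s) (arcs S) supporting))

boundaries-increasing : ∀ S → AllPairs _<_ (boundaries S)
boundaries-increasing S =
  All.tabulate positive ∷
  AllPairsₚ.++⁺ (AllPairsₚ.filter⁺ (T? ∘ _) (sites-increasing (len S))) ([] ∷ [])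
                (All.tabulate λ s∈F → s≤s (proj₂ (∈-sites⁻ (freeSites⊆sites S s∈F))) ∷ [])
  where
  positive : ∀ {s} → s ∈ freeSites S ++ [ suc (len S) ] → 0 < s
  positive s∈ with ∈-++⁻ (freeSites S) s∈
  ... | inj₁ s∈F         = proj₁ (∈-sites⁻ (freeSites⊆sites S s∈F))
  ... | inj₂ (here refl) = s≤s z≤n

boundaries-bounded : ∀ S → All (_≤ suc (len S)) (boundaries S)
boundaries-bounded S =
  z≤n ∷ Allₚ.++⁺ (All.tabulate λ s∈F → m≤n⇒m≤1+n (proj₂ (∈-sites⁻ (freeSites⊆sites S s∈F))))
                 (≤-refl ∷ [])

supporting⇒covered : ∀ S {s} → s ∈ sites (len S) → Supporting S s → Covers (blockList S) s
supporting⇒covered S {s} s∈sites supporting =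
  blocksAlong-covers {len S} (boundaries-increasing S) (proj₁ (∈-sites⁻ s∈sites)) not-boundary
    (Anyₚ.++⁺ʳ (freeSites S) (here (s≤s (proj₂ (∈-sites⁻ s∈sites))))) s∈sites
  where
  not-boundary : s ∉ freeSites S ++ [ suc (len S) ]
  not-boundary s∈ with ∈-++⁻ (freeSites S) s∈
  ... | inj₁ s∈F         = supporting⇒∉freeSites S supporting s∈F
  ... | inj₂ (here refl) = <-irrefl refl (proj₂ (∈-sites⁻ s∈sites))

arcs-covered : ∀ S → EndpointsCovered (blockList S) (arcs S)
arcs-covered S a∈ =
  let s₁∈sites , s₂∈sites , _ = arc-endpoints S a∈
      supporting₁ , supporting₂ = arc-endpoints-supporting S a∈
  in supporting⇒covered S s₁∈sites supporting₁ , supporting⇒covered S s₂∈sites supporting₂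

blockList-supporting : ∀ S {B s} → B ∈ blockList S → s ∈ B → Supporting S s
blockList-supporting S B∈ s∈B with a , b , refl ← ∈-blocksAlong⁻ {len S} B∈ =
  ∉freeSites⇒supporting S (block⊆sites (len S) a b s∈B)
    (λ s∈F → blocksAlong-avoids {len S} (boundaries-increasing S) B∈ s∈B (there (∈-++⁺ˡ s∈F)))

blockSizes≡gaps : ∀ S → map length (blockList S) ≡ gaps (boundaries S)
blockSizes≡gaps S = length-blocksAlong (boundaries S) (boundaries-bounded S)

module _ (S : Diagram) (binary : Binary S) where

  blockSize≡sum-incidence : ∀ {B} → B ∈ blockList S → length B ≡ sum (map (incidence B) (arcs S))
  blockSize≡sum-incidence {B} B∈ = begin
    length B
      ≡⟨ trans (sum-map-const 1 B) (*-identityˡ _) ⟨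
    sum (map (λ _ → 1) B)
      ≡⟨ sum-map-cong B (λ {s} s∈B → sym (binary⇒degree≡1 S {s} binary (blockList-supporting S B∈ s∈B))) ⟩
    sum (map (degree (arcs S)) B)
      ≡⟨ sum-degree≡sum-incidence (arcs S) unique (λ a∈ → <⇒≢ (proj₂ (proj₂ (arc-endpoints S a∈)))) ⟩
    sum (map (incidence B) (arcs S)) ∎
    where
    open ≡-Reasoning
    unique : Unique B
    unique with a , b , refl ← ∈-blocksAlong⁻ {len S} B∈ = block-unique (len S) a b

  rowSum+diagonal-blockMatrix : rowSum+diagonal (blockMatrix S) ≡ map length (blockList S)
  rowSum+diagonal-blockMatrix = trans (rowSum+diagonal-table (entry (arcs S)) (blockList S))
    (map-cong-local (All.tabulate λ B∈ →
      trans (row+diagonal≡sum-incidence nonoverlapping (arcs S) B∈ (arcs-covered S))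
            (sym (blockSize≡sum-incidence B∈))))
    where
    nonoverlapping : Nonoverlapping (blockList S)
    nonoverlapping = blocksAlong-nonoverlapping {len S} (boundaries-increasing S)

  sum-blockSizes : sum (map length (blockList S)) ≡ 2 * numArcs S
  sum-blockSizes = trans (sum-map-cong (blockList S) blockSize≡sum-incidence)
                         (sum-sum-incidence (blockList S) (arcs S) (arcs-covered S))

lemma5p4 : (S S' : Diagram) → Binary S → Binary S' →
    blockMatrix S ≡ blockMatrix S' →
    (numArcs S ≡ numArcs S') × (len S ≡ len S') × (blockList S ≡ blockList S')
lemma5p4 S S′ binary binary′ eq = numArcs≡ , len≡ , cong₂ blocksAlong len≡ (cong (0 ∷_) boundaries≡)
  where
  open ≡-Reasoning
  blockSizes≡ : map length (blockList S) ≡ map length (blockList S′)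
  blockSizes≡ = begin
    map length (blockList S)          ≡⟨ rowSum+diagonal-blockMatrix S binary ⟨
    rowSum+diagonal (blockMatrix S)   ≡⟨ cong rowSum+diagonal eq ⟩
    rowSum+diagonal (blockMatrix S′)  ≡⟨ rowSum+diagonal-blockMatrix S′ binary′ ⟩
    map length (blockList S′)         ∎
  boundaries≡ : freeSites S ++ [ suc (len S) ] ≡ freeSites S′ ++ [ suc (len S′) ]
  boundaries≡ = gaps-injective (boundaries-increasing S) (boundaries-increasing S′)
    (trans (sym (blockSizes≡gaps S)) (trans blockSizes≡ (blockSizes≡gaps S′)))
  len≡ : len S ≡ len S′
  len≡ = suc-injective (∷ʳ-injectiveʳ (freeSites S) (freeSites S′) boundaries≡)
  numArcs≡ : numArcs S ≡ numArcs S′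
  numArcs≡ = *-cancelˡ-≡ (numArcs S) (numArcs S′) 2
    (trans (sym (sum-blockSizes S binary)) (trans (cong sum blockSizes≡) (sum-blockSizes S′ binary′)))
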